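{- Let $n\ge1$ and let $F$ be an $\mathbb{F}_2$-linear subspace of $\mathbb{F}_2^n$ such that $J_nF\subseteq F$ and $F\subseteq\ker c$. Then $F\subseteq\ker S$.
   Context: $J_n$ is the $n\times n$ matrix over $\mathbb{F}_2$ with $1$'s directly above and below the diagonal and $0$'s elsewhere. $c:\mathbb{F}_2^n\to\mathbb{F}_2$ is $c(y_1,\dots,y_n)=\sum_{i=1}^ny_i$. $S:\mathbb{F}_2^n\to\mathbb{F}_2^{\lceil n/2\rceil}$ is defined by $S(y)=(y_1+y_n,y_2+y_{n-1},\dots,y_{n/2}+y_{n/2+1})$ if $n$ is even, and $S(y)=(y_1+y_n,y_2+y_{n-1},\dots,y_{\lceil n/2\rceil-1}+y_{\lceil n/2\rceil+1},y_{\lceil n/2\rceil})$ if $n$ is odd. -}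

module Defs where

open import Data.Bool using (Bool; true; false; _xor_; _∧_; _∨_; if_then_else_)
open import Data.Nat using (ℕ; suc; _+_; _*_; ⌈_/2⌉; _≡ᵇ_)
open import Data.Nat.Properties using (⌈n/2⌉≤n)
open import Data.Fin using (Fin; toℕ; inject≤; opposite)
open import Data.Vec using (Vec; []; _∷_; tabulate; lookup; zipWith; replicate; foldr′)
open import Relation.Binary.PropositionalEquality using (_≡_)

-- 𝔽₂ is modelled by Bool: addition = xor, multiplication = ∧, 0 = false, 1 = true.
𝔽₂ : Set
𝔽₂ = Bool

V : ℕ → Set
V n = Vec 𝔽₂ n

Σ₂ : ∀ {n} → V n → 𝔽₂
Σ₂ = foldr′ _xor_ false

_⊕_ : ∀ {n} → V n → V n → V n
_⊕_ = zipWith _xor_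

𝟎 : ∀ {n} → V n
𝟎 = replicate _ false

Mat : ℕ → ℕ → Set
Mat m n = Vec (Vec 𝔽₂ n) m

_·_ : ∀ {m n} → Mat m n → V n → V m
A · y = tabulate (λ i → Σ₂ (zipWith _∧_ (lookup A i) y))

adjacent : ℕ → ℕ → Bool
adjacent a b = (suc a ≡ᵇ b) ∨ (suc b ≡ᵇ a)

J : (n : ℕ) → Mat n n
J n = tabulate (λ i → tabulate (λ j → adjacent (toℕ i) (toℕ j)))

c : ∀ {n} → V n → 𝔽₂
c = Σ₂

-- S : 𝔽₂ⁿ → 𝔽₂^⌈n/2⌉ (0-based index i ↦ y_i + y_{n-1-i},
-- except for the middle coordinate when n is odd (2i+1 = n), which is y_i)
S : ∀ {n} → V n → V ⌈ n /2⌉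
S {n} y = tabulate λ i →
  let k = inject≤ i (⌈n/2⌉≤n n) in
  if (2 * toℕ i + 1 ≡ᵇ n) then lookup y k
  else (lookup y k xor lookup y (opposite k))

record IsSubspace {n : ℕ} (F : V n → Set) : Set where
  field
    zero-mem : F 𝟎
    add-mem  : ∀ {x y} → F x → F y → F (x ⊕ y)
    -- scalar multiplication by 0 or 1 is covered by zero-mem (0·x = 0, 1·x = x)

_⊆ker_ : ∀ {n m} → (V n → Set) → (V n → V m) → Set
F ⊆ker f = ∀ y → F y → f y ≡ 𝟎

-- Summing (J y)_i = y_{i-1} + y_{i+1} over i counts every interior coordinate of y
-- twice, so c (J y) = y_1 + y_n; since J y ∈ F ⊆ ker c, every y ∈ F has y_1 = y_n. The relation
-- y_i = y_{n+1-i} then propagates inwards: (J y)_i = (J y)_{n+1-i} together with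
-- y_{i-1} = y_{n+2-i} gives y_{i+1} = y_{n-i}. Hence every vector of F is a palindrome, which
-- kills the paired coordinates of S; for odd n the middle coordinate is c y = 0, all other
-- coordinates cancelling in pairs.
module Submission where

open import Data.Bool using (Bool; true; false; _xor_; _∧_; if_then_else_; T)
open import Data.Bool.Properties using (xor-assoc; xor-comm; xor-same; xor-identityʳ)
open import Data.Fin using (Fin; zero; suc; toℕ; fromℕ<; inject≤; opposite)
open import Data.Fin.Properties using (toℕ-fromℕ<; toℕ-inject≤; toℕ<n; opposite-prop)
open import Data.Nat using (ℕ; zero; suc; _+_; _*_; _∸_; _≤_; _<_; _≥_; z<s; s<s; s≤s; _≡ᵇ_)
open import Data.Nat.Properties using (≡ᵇ⇒≡; +-suc; m≤m+n; m≤n+m; m+[n∸m]≡n; ≤-refl; ≤-reflexive; ⌈n/2⌉≤n)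
open import Data.Nat.Tactic.RingSolver using (solve-∀)
open import Data.Product using (_×_; _,_; proj₁)
open import Data.Vec using ([]; _∷_; tabulate; lookup; zipWith)
open import Data.Vec.Properties using (lookup∘tabulate; tabulate-cong; tabulate∘lookup; lookup-replicate)
open import Function using (_∘_)
open import Relation.Binary.PropositionalEquality
  using (_≡_; refl; sym; trans; cong; cong₂; subst; module ≡-Reasoning)

open import Defs

open ≡-Reasoning

xor-cancelˡ : ∀ a b → a xor (a xor b) ≡ b
xor-cancelˡ a b = trans (sym (xor-assoc a a b)) (cong (_xor b) (xor-same a))

xor-telescope : ∀ a b c → (a xor b) xor (b xor c) ≡ a xor c
xor-telescope a b c = trans (xor-assoc a b (b xor c)) (cong (a xor_) (xor-cancelˡ b c))

xor-cancel : ∀ {a b c d} → a xor b ≡ c xor d → a ≡ d → b ≡ c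
xor-cancel {a} {b} {c} e refl = begin
  b                ≡⟨ sym (xor-cancelˡ a b) ⟩
  a xor (a xor b)  ≡⟨ cong (a xor_) (trans e (xor-comm c a)) ⟩
  a xor (a xor c)  ≡⟨ xor-cancelˡ a c ⟩
  c                ∎

xor≡false⇒≡ : ∀ {a b} → a xor b ≡ false → a ≡ b
xor≡false⇒≡ {false} {false} _ = refl
xor≡false⇒≡ {true}  {true}  _ = refl

≡⇒xor≡false : ∀ {a b} → a ≡ b → a xor b ≡ false
≡⇒xor≡false {a} refl = xor-same a

if-vanishes : ∀ b {p q : Bool} → (T b → p ≡ false) → q ≡ false → (if b then p else q) ≡ false
if-vanishes true  p≡false _ = p≡false _
if-vanishes false _ q≡false = q≡false

tabulate-false : ∀ {n} {f : Fin n → Bool} → (∀ i → f i ≡ false) → tabulate f ≡ 𝟎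
tabulate-false f≡false = begin
  tabulate _               ≡⟨ tabulate-cong (λ i → trans (f≡false i) (sym (lookup-replicate i false))) ⟩
  tabulate (lookup 𝟎)      ≡⟨ tabulate∘lookup 𝟎 ⟩
  𝟎                        ∎

toℕ+suc-opposite : ∀ {n} (k : Fin n) → toℕ k + suc (toℕ (opposite k)) ≡ n
toℕ+suc-opposite {n} k = begin
  toℕ k + suc (toℕ (opposite k))       ≡⟨ cong (λ m → toℕ k + suc m) (opposite-prop k) ⟩
  toℕ k + suc (n ∸ suc (toℕ k))        ≡⟨ +-suc (toℕ k) _ ⟩
  suc (toℕ k) + (n ∸ suc (toℕ k))      ≡⟨ m+[n∸m]≡n (toℕ<n k) ⟩
  n                                    ∎

suc[n+n]≡2*n+1 : ∀ n → suc (n + n) ≡ 2 * n + 1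
suc[n+n]≡2*n+1 = solve-∀

Σ< : (ℕ → Bool) → ℕ → Bool
Σ< f zero    = false
Σ< f (suc m) = f 0 xor Σ< (f ∘ suc) m

Σ<-cong : ∀ {f g : ℕ → Bool} {m} → (∀ a → a < m → f a ≡ g a) → Σ< f m ≡ Σ< g m
Σ<-cong {m = zero}  _   = refl
Σ<-cong {m = suc m} f≡g = cong₂ _xor_ (f≡g 0 z<s) (Σ<-cong (λ a a<m → f≡g (suc a) (s<s a<m)))

Σ<-suc : ∀ (f : ℕ → Bool) m → Σ< f (suc m) ≡ Σ< f m xor f m
Σ<-suc f zero    = xor-comm (f 0) false
Σ<-suc f (suc m) = trans (cong (f 0 xor_) (Σ<-suc (f ∘ suc) m)) (sym (xor-assoc (f 0) _ _))

Σ<-telescope : ∀ (g : ℕ → Bool) m → Σ< (λ a → g a xor g (suc a)) m ≡ g 0 xor g m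
Σ<-telescope g zero    = sym (xor-same (g 0))
Σ<-telescope g (suc m) =
  trans (cong ((g 0 xor g 1) xor_) (Σ<-telescope (g ∘ suc) m)) (xor-telescope (g 0) (g 1) (g (suc m)))

Σ<-palindrome : ∀ k (f : ℕ → Bool) → (∀ i j → i + j ≡ k + k → f i ≡ f j) → Σ< f (suc (k + k)) ≡ f k
Σ<-palindrome zero    f _        = xor-identityʳ (f 0)
Σ<-palindrome (suc k) f symmetric = begin
  Σ< f (suc (suc k + suc k))                ≡⟨ cong (λ m → Σ< f (suc (suc m))) (+-suc k k) ⟩
  f 0 xor Σ< (f ∘ suc) (suc (suc (k + k)))  ≡⟨ cong (f 0 xor_) (Σ<-suc (f ∘ suc) (suc (k + k))) ⟩
  f 0 xor (Σ< (f ∘ suc) (suc (k + k)) xor f last)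
    ≡⟨ cong₂ (λ s t → f 0 xor (s xor t)) (Σ<-palindrome k (f ∘ suc) inner-symmetric) (sym outer) ⟩
  f 0 xor (f (suc k) xor f 0)               ≡⟨ cong (f 0 xor_) (xor-comm (f (suc k)) (f 0)) ⟩
  f 0 xor (f 0 xor f (suc k))               ≡⟨ xor-cancelˡ (f 0) (f (suc k)) ⟩
  f (suc k)                                 ∎
  where
  last = suc (suc (k + k))

  outer : f 0 ≡ f last
  outer = symmetric 0 last (cong suc (sym (+-suc k k)))

  inner-symmetric : ∀ i j → i + j ≡ k + k → f (suc i) ≡ f (suc j)
  inner-symmetric i j i+j≡k+k =
    symmetric (suc i) (suc j) (cong suc (trans (+-suc i j) (trans (cong suc i+j≡k+k) (sym (+-suc k k)))))

-- y ! a is the paper's y_{a+1}, read as 0 beyond the end.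
_!_ : ∀ {n} → V n → ℕ → Bool
[]       ! _     = false
(x ∷ xs) ! zero  = x
(x ∷ xs) ! suc a = xs ! a

!-lookup : ∀ {n} (v : V n) (k : Fin n) → v ! toℕ k ≡ lookup v k
!-lookup (x ∷ xs) zero    = refl
!-lookup (x ∷ xs) (suc k) = !-lookup xs k

!-out : ∀ {n} (v : V n) {a} → n ≤ a → v ! a ≡ false
!-out []       _         = refl
!-out (x ∷ xs) (s≤s n≤a) = !-out xs n≤a

Σ₂≡Σ< : ∀ {n} (v : V n) → Σ₂ v ≡ Σ< (v !_) n
Σ₂≡Σ< []       = refl
Σ₂≡Σ< (x ∷ xs) = cong (x xor_) (Σ₂≡Σ< xs)

shiftʳ : (ℕ → Bool) → ℕ → Bool
shiftʳ f zero    = false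
shiftʳ f (suc a) = f a

_∙_ : ∀ {n} → V n → V n → Bool
r ∙ y = Σ₂ (zipWith _∧_ r y)

false∙ : ∀ {n} (y : V n) → tabulate (λ _ → false) ∙ y ≡ false
false∙ []       = refl
false∙ (x ∷ xs) = false∙ xs

adjacent∙ : ∀ {n} (y : V n) a → tabulate (adjacent a ∘ toℕ) ∙ y ≡ shiftʳ (y !_) a xor y ! suc a
adjacent∙ []            zero          = refl
adjacent∙ []            (suc a)       = refl
adjacent∙ (x ∷ [])      zero          = refl
adjacent∙ (x ∷ x′ ∷ xs) zero          = trans (cong (x′ xor_) (false∙ xs)) (xor-identityʳ x′)
adjacent∙ (x ∷ xs)      (suc zero)    = cong (x xor_) (adjacent∙ xs zero)
adjacent∙ (x ∷ xs)      (suc (suc a)) = adjacent∙ xs (suc a)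

lookup-J· : ∀ {n} (y : V n) (k : Fin n) → lookup (J n · y) k ≡ shiftʳ (y !_) (toℕ k) xor y ! suc (toℕ k)
lookup-J· {n} y k = begin
  lookup (J n · y) k                             ≡⟨ lookup∘tabulate _ k ⟩
  lookup (J n) k ∙ y                             ≡⟨ cong (_∙ y) (lookup∘tabulate _ k) ⟩
  tabulate (adjacent (toℕ k) ∘ toℕ) ∙ y          ≡⟨ adjacent∙ y (toℕ k) ⟩
  shiftʳ (y !_) (toℕ k) xor y ! suc (toℕ k)      ∎

J·-! : ∀ {n} (y : V n) {a} → a < n → (J n · y) ! a ≡ shiftʳ (y !_) a xor y ! suc a
J·-! {n} y {a} a<n = begin
  (J n · y) ! a                                  ≡⟨ cong ((J n · y) !_) (sym (toℕ-fromℕ< a<n)) ⟩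
  (J n · y) ! toℕ k                              ≡⟨ !-lookup (J n · y) k ⟩
  lookup (J n · y) k                             ≡⟨ lookup-J· y k ⟩
  shiftʳ (y !_) (toℕ k) xor y ! suc (toℕ k)      ≡⟨ cong (λ b → shiftʳ (y !_) b xor y ! suc b) (toℕ-fromℕ< a<n) ⟩
  shiftʳ (y !_) a xor y ! suc a                  ∎
  where k = fromℕ< a<n

-- Each coordinate of J y is a difference of consecutive terms of g, so the sum telescopes.
Σ₂-J· : ∀ {n} (y : V n) → Σ₂ (J n · y) ≡ y ! 0 xor shiftʳ (y !_) n
Σ₂-J· {n} y = begin
  Σ₂ (J n · y)                          ≡⟨ Σ₂≡Σ< (J n · y) ⟩
  Σ< ((J n · y) !_) n                   ≡⟨ Σ<-cong (λ a a<n → trans (J·-! y a<n) (sym (xor-telescope (shiftʳ (y !_) a) (y ! a) (y ! suc a)))) ⟩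
  Σ< (λ a → g a xor g (suc a)) n        ≡⟨ Σ<-telescope g n ⟩
  y ! 0 xor (shiftʳ (y !_) n xor y ! n) ≡⟨ cong (λ b → y ! 0 xor (shiftʳ (y !_) n xor b)) (!-out y ≤-refl) ⟩
  y ! 0 xor (shiftʳ (y !_) n xor false) ≡⟨ cong (y ! 0 xor_) (xor-identityʳ _) ⟩
  y ! 0 xor shiftʳ (y !_) n             ∎
  where
  g : ℕ → Bool
  g a = shiftʳ (y !_) a xor y ! a

J·-mirror-step : ∀ {n} (y : V n) {i j} → suc i + suc j ≡ n
               → (J n · y) ! i ≡ (J n · y) ! suc j → shiftʳ (y !_) i ≡ y ! suc (suc j)
               → y ! suc i ≡ y ! j
J·-mirror-step y {i} {j} i+j+2≡n Jy-mirrored y-mirrored = xor-cancel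
  (trans (sym (J·-! y i<n)) (trans Jy-mirrored (J·-! y j+1<n)))
  y-mirrored
  where
  i<n   = subst (i <_) i+j+2≡n (m≤m+n (suc i) (suc j))
  j+1<n = subst (suc j <_) i+j+2≡n (s≤s (m≤n+m (suc j) i))

module JInvariant {n} (F : V n → Set)
                  (J-closed : ∀ y → F y → F (J n · y))
                  (c-vanishes : ∀ y → F y → c y ≡ false) where

  Mirrored : ℕ → Set
  Mirrored i = ∀ {y j} → F y → i + suc j ≡ n → y ! i ≡ y ! j

  mirrored-0 : Mirrored 0
  mirrored-0 {y} {j} Fy j+1≡n = xor≡false⇒≡ (begin
    y ! 0 xor y ! j              ≡⟨ cong (λ m → y ! 0 xor shiftʳ (y !_) m) j+1≡n ⟩
    y ! 0 xor shiftʳ (y !_) n    ≡⟨ sym (Σ₂-J· y) ⟩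
    Σ₂ (J n · y)                 ≡⟨ c-vanishes _ (J-closed y Fy) ⟩
    false                        ∎)

  mirrored-1 : Mirrored 1
  mirrored-1 {y} Fy j+2≡n =
    J·-mirror-step y j+2≡n (mirrored-0 (J-closed y Fy) j+2≡n) (sym (!-out y (≤-reflexive (sym j+2≡n))))

  mirrored-2+ : ∀ {i} → Mirrored i → Mirrored (suc i) → Mirrored (suc (suc i))
  mirrored-2+ {i} mi msi {y} {j} Fy i+j+3≡n =
    J·-mirror-step y i+j+3≡n (msi (J-closed y Fy) i+j+3≡n′) (mi Fy (trans (+-suc i (suc (suc j))) i+j+3≡n′))
    where
    i+j+3≡n′ : suc i + suc (suc j) ≡ n
    i+j+3≡n′ = trans (cong suc (+-suc i (suc j))) i+j+3≡n

  mirrored-pair : ∀ i → Mirrored i × Mirrored (suc i)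
  mirrored-pair zero    = mirrored-0 , mirrored-1
  mirrored-pair (suc i) with mirrored-pair i
  ... | mi , msi = msi , mirrored-2+ mi msi

  mirrored : ∀ {i} → Mirrored i
  mirrored {i} = proj₁ (mirrored-pair i)

  middle-vanishes : ∀ {y} → F y → (k : Fin n) → 2 * toℕ k + 1 ≡ n → lookup y k ≡ false
  middle-vanishes {y} Fy k 2k+1≡n = begin
    lookup y k                  ≡⟨ sym (!-lookup y k) ⟩
    y ! t                       ≡⟨ sym (Σ<-palindrome t (y !_) (λ i j i+j≡t+t → mirrored Fy (around i j i+j≡t+t))) ⟩
    Σ< (y !_) (suc (t + t))     ≡⟨ cong (Σ< (y !_)) 2t+1≡n ⟩
    Σ< (y !_) n                 ≡⟨ sym (Σ₂≡Σ< y) ⟩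
    Σ₂ y                        ≡⟨ c-vanishes y Fy ⟩
    false                       ∎
    where
    t = toℕ k

    2t+1≡n : suc (t + t) ≡ n
    2t+1≡n = trans (suc[n+n]≡2*n+1 t) 2k+1≡n

    around : ∀ i j → i + j ≡ t + t → i + suc j ≡ n
    around i j i+j≡t+t = trans (+-suc i j) (trans (cong suc i+j≡t+t) 2t+1≡n)

  opposite-vanishes : ∀ {y} → F y → (k : Fin n) → lookup y k xor lookup y (opposite k) ≡ false
  opposite-vanishes {y} Fy k = ≡⇒xor≡false (begin
    lookup y k                  ≡⟨ sym (!-lookup y k) ⟩
    y ! toℕ k                   ≡⟨ mirrored Fy (toℕ+suc-opposite k) ⟩
    y ! toℕ (opposite k)        ≡⟨ !-lookup y (opposite k) ⟩
    lookup y (opposite k)       ∎)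

  ⊆ker-S : F ⊆ker S
  ⊆ker-S y Fy = tabulate-false λ i →
    let k = inject≤ i (⌈n/2⌉≤n n) in
    if-vanishes (2 * toℕ i + 1 ≡ᵇ n)
      (λ odd → middle-vanishes Fy k (trans (cong (λ t → 2 * t + 1) (toℕ-inject≤ i _)) (≡ᵇ⇒≡ _ _ odd)))
      (opposite-vanishes Fy k)

lemma7 : (n : ℕ) → n ≥ 1 → (F : V n → Set) → IsSubspace F
       → (∀ y → F y → F (J n · y))
       → (∀ y → F y → c y ≡ false)
       → F ⊆ker S
lemma7 _ _ F _ J-closed c-vanishes = JInvariant.⊆ker-S F J-closed c-vanishes
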